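{- Let $\phi$ be a Boolean formula in variables $y_1,\dots,y_m$, let $s\ge1$, $\lambda\in(0,\tfrac12]$, and $\rho=1-2\lambda$. Let $c_1,\dots,c_s$ be XOR constraints drawn independently from the distribution below, let $\chi_s=\phi\wedge c_1\wedge\cdots\wedge c_s$, and for an assignment $\sigma$ let $Y_\sigma$ be the Bernoulli random variable equal to $1$ iff $\sigma$ satisfies $\chi_s$. Then: (1) for every model $\sigma$ of $\phi$, $\Pr(Y_\sigma=1)=E[Y_\sigma]=2^{ -s}$; (2) for any two models $\sigma,\sigma'$ of $\phi$ at Hamming distance $d$ in $\mathbb{F}_2^m$, $\Pr(Y_\sigma=1,Y_{\sigma'}=1)=E[Y_\sigma Y_{\sigma'}]=\left(\frac{1+\rho^d}{4}\right)^s$, where $\rho^d$ is taken to be $1$ when $\rho=d=0$.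
   Context: An XOR constraint on $y_1,\dots,y_m$ is an equation $a_0=a_1y_1\oplus\cdots\oplus a_my_m$ with $(a_0,\dots,a_m)\in\mathbb{F}_2^{m+1}$. Constraints are drawn from the distribution $\Pr(a_0,a_1,\dots,a_m)=p(a_0)p'(a_1)\cdots p'(a_m)$ with $p(0)=p(1)=\tfrac12$, $p'(1)=\lambda$, $p'(0)=1-\lambda$, i.e. $a_0$ uniform and each $a_i$ ($i\ge1$) equal to $1$ independently with probability $\lambda$. Hamming distance between assignments is the number of variables on which they differ.
   Formalization: The parameter λ takes only rational values in (0,½]. -}

module Defs where

open import Data.Bool using (Bool; true; false; _∧_; _∨_; not; _xor_; if_then_else_)
open import Relation.Binary.PropositionalEquality using (_≡_)
open import Data.Nat using (ℕ; zero; suc)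
open import Data.Fin using (Fin)
open import Data.Vec using (Vec; []; _∷_; lookup; zipWith; foldr)
open import Data.List using (List; []; _∷_; map; concatMap)
open import Data.Product using (_×_; _,_)
open import Data.Rational using (ℚ; 0ℚ; 1ℚ; ½; _+_; _*_; _-_)

data Formula (m : ℕ) : Set where
  var  : Fin m → Formula m
  ⊤f   : Formula m
  ⊥f   : Formula m
  ¬f_  : Formula m → Formula m
  _∧f_ : Formula m → Formula m → Formula m
  _∨f_ : Formula m → Formula m → Formula m

-- Assignments: elements of F_2^m (true = 1)
Assignment : ℕ → Set
Assignment m = Vec Bool m

eval : ∀ {m} → Formula m → Assignment m → Bool
eval (var i)   σ = lookup σ i
eval ⊤f        σ = true
eval ⊥f        σ = false
eval (¬f φ)    σ = not (eval φ σ)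
eval (φ ∧f ψ)  σ = eval φ σ ∧ eval ψ σ
eval (φ ∨f ψ)  σ = eval φ σ ∨ eval ψ σ

Model : ∀ {m} → Formula m → Assignment m → Set
Model φ σ = eval φ σ ≡ true

-- XOR constraint a_0 = a_1 y_1 ⊕ ... ⊕ a_m y_m, stored as (a_0 , (a_1,...,a_m))
XorConstraint : ℕ → Set
XorConstraint m = Bool × Vec Bool m

xorSum : ∀ {m} → Vec Bool m → Assignment m → Bool
xorSum a σ = foldr _ _xor_ false (zipWith _∧_ a σ)

satXor : ∀ {m} → Assignment m → XorConstraint m → Bool
satXor σ (a₀ , a) = not (a₀ xor xorSum a σ)

-- natural-number powers in ℚ (with q ^ 0 = 1, in particular 0 ^ 0 = 1)
_^ℚ_ : ℚ → ℕ → ℚ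
q ^ℚ zero  = 1ℚ
q ^ℚ suc n = q * (q ^ℚ n)

hamming : ∀ {m} → Assignment m → Assignment m → ℕ
hamming []       []       = zero
hamming (x ∷ xs) (y ∷ ys) = if x xor y then suc (hamming xs ys) else hamming xs ys

allBools : List Bool
allBools = false ∷ true ∷ []

allVecs : (m : ℕ) → List (Vec Bool m)
allVecs zero    = [] ∷ []
allVecs (suc m) = concatMap (λ b → map (b ∷_) (allVecs m)) allBools

allConstraints : (m : ℕ) → List (XorConstraint m)
allConstraints m = concatMap (λ a₀ → map (a₀ ,_) (allVecs m)) allBools

allSeqs : (m s : ℕ) → List (Vec (XorConstraint m) s)
allSeqs m zero    = [] ∷ []
allSeqs m (suc s) = concatMap (λ c → map (c ∷_) (allSeqs m s)) (allConstraints m)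

-- probability of a single constraint: p(a_0) p'(a_1) ... p'(a_m),
-- p(0)=p(1)=1/2, p'(1)=λ, p'(0)=1-λ
p′ : ℚ → Bool → ℚ
p′ lam true  = lam
p′ lam false = 1ℚ - lam

constraintProb : ∀ {m} → ℚ → XorConstraint m → ℚ
constraintProb lam (a₀ , a) = ½ * foldr _ (λ b r → p′ lam b * r) 1ℚ a

seqProb : ∀ {m s} → ℚ → Vec (XorConstraint m) s → ℚ
seqProb lam []       = 1ℚ
seqProb lam (c ∷ cs) = constraintProb lam c * seqProb lam cs

sumℚ : List ℚ → ℚ
sumℚ []       = 0ℚ
sumℚ (x ∷ xs) = x + sumℚ xs

Expect : (m s : ℕ) → ℚ → (Vec (XorConstraint m) s → ℚ) → ℚ
Expect m s lam X = sumℚ (map (λ cs → seqProb lam cs * X cs) (allSeqs m s))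

Prob : (m s : ℕ) → ℚ → (Vec (XorConstraint m) s → Bool) → ℚ
Prob m s lam E = sumℚ (map (λ cs → if E cs then seqProb lam cs else 0ℚ) (allSeqs m s))

satχ : ∀ {m s} → Formula m → Assignment m → Vec (XorConstraint m) s → Bool
satχ φ σ cs = eval φ σ ∧ foldr _ (λ c r → satXor σ c ∧ r) true cs

Y : ∀ {m s} → Formula m → Assignment m → Vec (XorConstraint m) s → ℚ
Y φ σ cs = if satχ φ σ cs then 1ℚ else 0ℚ

-- A single constraint (a₀ , a) is satisfied by σ iff a₀ = a·σ, which for uniform a₀ has
-- probability ½ whatever a is. It is satisfied by both σ and σ′ iff moreover a·σ = a·σ′,
-- an event of probability ½ (1 + E[(-1)^(a·σ ⊕ a·σ′)]); since the coordinates of a are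
-- independent, this expectation is the product over the d coordinates where σ and σ′ differ
-- of (1 - λ) - λ = ρ. The s constraints are independent, so both probabilities are s-th powers.
module Submission where

open import Defs
open import Algebra using (CommutativeRing)
open import Data.Bool using (Bool; true; false; _∧_; not; _xor_; if_then_else_)
open import Data.Bool.Properties using (∧-zeroʳ; xor-∧-commutativeRing)
open import Algebra.Properties.CommutativeSemigroup
  (CommutativeRing.+-commutativeSemigroup xor-∧-commutativeRing) using (interchange)
open import Data.List using (List; []; _∷_; map; concatMap; _++_)
open import Data.Nat using (ℕ; _≥_; zero; suc)
open import Data.Product using (_×_; _,_)
open import Data.Rational using (ℚ; 0ℚ; 1ℚ; ½; _+_; _*_; _-_; _<_; _≤_; -_)
open import Data.Rational.Properties
  using (+-identityˡ; +-identityʳ; *-identityˡ; *-identityʳ; *-zeroˡ; *-zeroʳ; *-distribˡ-+; *-comm; *-assoc; +-assoc)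
open import Data.Rational.Solver using (module +-*-Solver)
open import Data.Vec using (Vec; []; _∷_; foldr)
open import Relation.Binary.PropositionalEquality
  using (_≡_; refl; sym; trans; cong; cong₂; module ≡-Reasoning)
open +-*-Solver
open ≡-Reasoning

∑ : {A : Set} → List A → (A → ℚ) → ℚ
∑ xs f = sumℚ (map f xs)

∑-cong : {A : Set} (xs : List A) {f g : A → ℚ} → (∀ x → f x ≡ g x) → ∑ xs f ≡ ∑ xs g
∑-cong []       f≡g = refl
∑-cong (x ∷ xs) f≡g = cong₂ _+_ (f≡g x) (∑-cong xs f≡g)

∑-0 : {A : Set} (xs : List A) → ∑ xs (λ _ → 0ℚ) ≡ 0ℚ
∑-0 []       = refl
∑-0 (x ∷ xs) = trans (+-identityˡ _) (∑-0 xs)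

∑-+ : {A : Set} (xs : List A) (f g : A → ℚ) → ∑ xs (λ x → f x + g x) ≡ ∑ xs f + ∑ xs g
∑-+ []       f g = sym (+-identityˡ 0ℚ)
∑-+ (x ∷ xs) f g = begin
  (f x + g x) + ∑ xs (λ x → f x + g x) ≡⟨ cong ((f x + g x) +_) (∑-+ xs f g) ⟩
  (f x + g x) + (∑ xs f + ∑ xs g)       ≡⟨ solve 4 (λ a b c d → (a :+ b) :+ (c :+ d) := (a :+ c) :+ (b :+ d))
                                                  refl (f x) (g x) (∑ xs f) (∑ xs g) ⟩
  (f x + ∑ xs f) + (g x + ∑ xs g)       ∎

∑-*ˡ : {A : Set} (xs : List A) (c : ℚ) (f : A → ℚ) → ∑ xs (λ x → c * f x) ≡ c * ∑ xs f
∑-*ˡ []       c f = sym (*-zeroʳ c)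
∑-*ˡ (x ∷ xs) c f = trans (cong (c * f x +_) (∑-*ˡ xs c f)) (sym (*-distribˡ-+ c (f x) _))

∑-*ʳ : {A : Set} (xs : List A) (c : ℚ) (f : A → ℚ) → ∑ xs (λ x → f x * c) ≡ ∑ xs f * c
∑-*ʳ xs c f = begin
  ∑ xs (λ x → f x * c) ≡⟨ ∑-cong xs (λ x → *-comm (f x) c) ⟩
  ∑ xs (λ x → c * f x) ≡⟨ ∑-*ˡ xs c f ⟩
  c * ∑ xs f           ≡⟨ *-comm c _ ⟩
  ∑ xs f * c           ∎

∑∑-* : {A B : Set} (xs : List A) (ys : List B) (f : A → ℚ) (g : B → ℚ) →
       ∑ xs (λ x → ∑ ys (λ y → f x * g y)) ≡ ∑ xs f * ∑ ys g
∑∑-* xs ys f g = trans (∑-cong xs (λ x → ∑-*ˡ ys (f x) g)) (∑-*ʳ xs (∑ ys g) f)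

∑-++ : {A : Set} (xs ys : List A) (f : A → ℚ) → ∑ (xs ++ ys) f ≡ ∑ xs f + ∑ ys f
∑-++ []       ys f = sym (+-identityˡ _)
∑-++ (x ∷ xs) ys f = trans (cong (f x +_) (∑-++ xs ys f)) (sym (+-assoc (f x) _ _))

∑-map : {A B : Set} (h : A → B) (xs : List A) (f : B → ℚ) → ∑ (map h xs) f ≡ ∑ xs (λ x → f (h x))
∑-map h []       f = refl
∑-map h (x ∷ xs) f = cong (f (h x) +_) (∑-map h xs f)

∑-concatMap : {A B : Set} (h : A → List B) (xs : List A) (f : B → ℚ) →
              ∑ (concatMap h xs) f ≡ ∑ xs (λ x → ∑ (h x) f)
∑-concatMap h []       f = refl
∑-concatMap h (x ∷ xs) f = trans (∑-++ (h x) (concatMap h xs) f) (cong (∑ (h x) f +_) (∑-concatMap h xs f))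

∑-allBools : {A : Set} (h : Bool → List A) (f : A → ℚ) →
             ∑ (concatMap h allBools) f ≡ ∑ (h false) f + ∑ (h true) f
∑-allBools h f = trans (∑-concatMap h allBools f) (cong (∑ (h false) f +_) (+-identityʳ _))

∑-allVecs-suc : (m : ℕ) (f : Vec Bool (suc m) → ℚ) →
                ∑ (allVecs (suc m)) f ≡ ∑ (allVecs m) (λ a → f (false ∷ a)) + ∑ (allVecs m) (λ a → f (true ∷ a))
∑-allVecs-suc m f = trans (∑-allBools (λ b → map (b ∷_) (allVecs m)) f)
                          (cong₂ _+_ (∑-map (false ∷_) (allVecs m) f) (∑-map (true ∷_) (allVecs m) f))

∑-allConstraints : (m : ℕ) (f : XorConstraint m → ℚ) →
                   ∑ (allConstraints m) f ≡ ∑ (allVecs m) (λ a → f (false , a) + f (true , a))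
∑-allConstraints m f = begin
  ∑ (allConstraints m) f                                              ≡⟨ ∑-allBools (λ b → map (b ,_) (allVecs m)) f ⟩
  ∑ (map (false ,_) (allVecs m)) f + ∑ (map (true ,_) (allVecs m)) f  ≡⟨ cong₂ _+_ (∑-map (false ,_) (allVecs m) f)
                                                                                       (∑-map (true ,_) (allVecs m) f) ⟩
  ∑ (allVecs m) (λ a → f (false , a)) + ∑ (allVecs m) (λ a → f (true , a)) ≡⟨ sym (∑-+ (allVecs m) _ _) ⟩
  ∑ (allVecs m) (λ a → f (false , a) + f (true , a))                  ∎

∑-allSeqs-suc : (m s : ℕ) (f : Vec (XorConstraint m) (suc s) → ℚ) →
                ∑ (allSeqs m (suc s)) f ≡ ∑ (allConstraints m) (λ c → ∑ (allSeqs m s) (λ cs → f (c ∷ cs)))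
∑-allSeqs-suc m s f = trans (∑-concatMap (λ c → map (c ∷_) (allSeqs m s)) (allConstraints m) f)
                            (∑-cong (allConstraints m) (λ c → ∑-map (c ∷_) (allSeqs m s) f))

𝟙 : Bool → ℚ → ℚ
𝟙 b q = if b then q else 0ℚ

𝟙-∧ : ∀ b b′ (p q : ℚ) → 𝟙 (b ∧ b′) (p * q) ≡ 𝟙 b p * 𝟙 b′ q
𝟙-∧ true  true  p q = refl
𝟙-∧ true  false p q = sym (*-zeroʳ p)
𝟙-∧ false b′    p q = sym (*-zeroˡ (𝟙 b′ q))

𝟙-* : ∀ b (p : ℚ) → p * 𝟙 b 1ℚ ≡ 𝟙 b p
𝟙-* true  p = *-identityʳ p
𝟙-* false p = *-zeroʳ p

𝟙-1-∧ : ∀ b b′ → 𝟙 b 1ℚ * 𝟙 b′ 1ℚ ≡ 𝟙 (b ∧ b′) 1ℚ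
𝟙-1-∧ true  b′ = *-identityˡ _
𝟙-1-∧ false b′ = *-zeroˡ (𝟙 b′ 1ℚ)

Expect-indicator : ∀ m s lam (E : Vec (XorConstraint m) s → Bool) →
                   Expect m s lam (λ cs → 𝟙 (E cs) 1ℚ) ≡ Prob m s lam E
Expect-indicator m s lam E = ∑-cong (allSeqs m s) (λ cs → 𝟙-* (E cs) (seqProb lam cs))

Prob-cong : ∀ m s lam {E F : Vec (XorConstraint m) s → Bool} → (∀ cs → E cs ≡ F cs) → Prob m s lam E ≡ Prob m s lam F
Prob-cong m s lam E≡F = ∑-cong (allSeqs m s) (λ cs → cong (λ b → 𝟙 b (seqProb lam cs)) (E≡F cs))

weight : ℚ → {m : ℕ} → Vec Bool m → ℚ
weight lam a = foldr _ (λ b r → p′ lam b * r) 1ℚ a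

∑-weight : ∀ lam m → ∑ (allVecs m) (weight lam) ≡ 1ℚ
∑-weight lam zero    = +-identityʳ 1ℚ
∑-weight lam (suc m) = begin
  ∑ (allVecs (suc m)) (weight lam)                       ≡⟨ ∑-allVecs-suc m (weight lam) ⟩
  ∑ (allVecs m) (λ a → (1ℚ - lam) * weight lam a) + ∑ (allVecs m) (λ a → lam * weight lam a)
                                                         ≡⟨ cong₂ _+_ (∑-*ˡ (allVecs m) (1ℚ - lam) (weight lam))
                                                                      (∑-*ˡ (allVecs m) lam (weight lam)) ⟩
  (1ℚ - lam) * ∑ (allVecs m) (weight lam) + lam * ∑ (allVecs m) (weight lam)
                                                         ≡⟨ cong (λ t → (1ℚ - lam) * t + lam * t) (∑-weight lam m) ⟩
  (1ℚ - lam) * 1ℚ + lam * 1ℚ                             ≡⟨ solve 1 (λ l → (con 1ℚ :- l) :* con 1ℚ :+ l :* con 1ℚ := con 1ℚ) refl lam ⟩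
  1ℚ                                                     ∎

sign : Bool → ℚ
sign false = 1ℚ
sign true  = - 1ℚ

sign-xor : ∀ x y → sign (x xor y) ≡ sign x * sign y
sign-xor false y     = sym (*-identityˡ _)
sign-xor true  false = refl
sign-xor true  true  = refl

ρ : ℚ → ℚ
ρ lam = 1ℚ - (lam + lam)

bias-step : ∀ lam d h → (1ℚ - lam) * ρ lam ^ℚ h + lam * sign d * ρ lam ^ℚ h
                        ≡ ρ lam ^ℚ (if d then suc h else h)
bias-step lam false h = solve 2 (λ l r → (con 1ℚ :- l) :* r :+ l :* con 1ℚ :* r := r) refl lam (ρ lam ^ℚ h)
bias-step lam true  h = solve 2 (λ l r → (con 1ℚ :- l) :* r :+ l :* (:- con 1ℚ) :* r := (con 1ℚ :- (l :+ l)) :* r)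
                          refl lam (ρ lam ^ℚ h)

∑-weight*sign≡ρ^hamming : ∀ lam {m} (σ σ′ : Assignment m) →
  ∑ (allVecs m) (λ a → weight lam a * sign (xorSum a σ xor xorSum a σ′)) ≡ ρ lam ^ℚ hamming σ σ′
∑-weight*sign≡ρ^hamming lam []      []        = trans (+-identityʳ _) (*-identityˡ 1ℚ)
∑-weight*sign≡ρ^hamming lam {suc m} (y ∷ σ) (y′ ∷ σ′) = begin
  ∑ (allVecs (suc m)) F                                             ≡⟨ ∑-allVecs-suc m F ⟩
  ∑ (allVecs m) (λ a → F (false ∷ a)) + ∑ (allVecs m) (λ a → F (true ∷ a))
                                                                    ≡⟨ cong₂ _+_ (trans (∑-cong (allVecs m) F-false) (∑-*ˡ (allVecs m) (1ℚ - lam) f))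
                                                                                 (trans (∑-cong (allVecs m) F-true) (∑-*ˡ (allVecs m) (lam * sign (y xor y′)) f)) ⟩
  (1ℚ - lam) * ∑ (allVecs m) f + lam * sign (y xor y′) * ∑ (allVecs m) f
                                                                    ≡⟨ cong (λ t → (1ℚ - lam) * t + lam * sign (y xor y′) * t)
                                                                            (∑-weight*sign≡ρ^hamming lam σ σ′) ⟩
  (1ℚ - lam) * ρ lam ^ℚ hamming σ σ′ + lam * sign (y xor y′) * ρ lam ^ℚ hamming σ σ′
                                                                    ≡⟨ bias-step lam (y xor y′) (hamming σ σ′) ⟩
  ρ lam ^ℚ hamming (y ∷ σ) (y′ ∷ σ′)                                ∎
  where
  f : Vec Bool m → ℚ
  f a = weight lam a * sign (xorSum a σ xor xorSum a σ′)
  F : Vec Bool (suc m) → ℚ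
  F a = weight lam a * sign (xorSum a (y ∷ σ) xor xorSum a (y′ ∷ σ′))
  F-false : ∀ a → F (false ∷ a) ≡ (1ℚ - lam) * f a
  F-false a = *-assoc (1ℚ - lam) (weight lam a) _
  F-true : ∀ a → F (true ∷ a) ≡ lam * sign (y xor y′) * f a
  F-true a = begin
    lam * weight lam a * sign ((y xor xorSum a σ) xor (y′ xor xorSum a σ′))
      ≡⟨ cong (λ b → lam * weight lam a * sign b) (interchange y (xorSum a σ) y′ (xorSum a σ′)) ⟩
    lam * weight lam a * sign ((y xor y′) xor (xorSum a σ xor xorSum a σ′))
      ≡⟨ cong (lam * weight lam a *_) (sign-xor (y xor y′) _) ⟩
    lam * weight lam a * (sign (y xor y′) * sign (xorSum a σ xor xorSum a σ′))
      ≡⟨ solve 4 (λ l w e g → l :* w :* (e :* g) := l :* e :* (w :* g)) refl lam (weight lam a) (sign (y xor y′)) _ ⟩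
    lam * sign (y xor y′) * f a ∎

Prob₁ : ℚ → {m : ℕ} → (XorConstraint m → Bool) → ℚ
Prob₁ lam {m} E = ∑ (allConstraints m) (λ c → 𝟙 (E c) (constraintProb lam c))

∑-a₀-sat : ∀ x v → 𝟙 (not (false xor x)) v + 𝟙 (not (true xor x)) v ≡ v
∑-a₀-sat false v = +-identityʳ v
∑-a₀-sat true  v = +-identityˡ v

∑-a₀-sat-both : ∀ x x′ v → 𝟙 (not (false xor x) ∧ not (false xor x′)) v + 𝟙 (not (true xor x) ∧ not (true xor x′)) v
                           ≡ v * ½ * (1ℚ + sign (x xor x′))
∑-a₀-sat-both false false v = solve 1 (λ v → v :+ con 0ℚ := v :* con ½ :* (con 1ℚ :+ con 1ℚ)) refl v
∑-a₀-sat-both false true  v = solve 1 (λ v → con 0ℚ :+ con 0ℚ := v :* con ½ :* (con 1ℚ :+ :- con 1ℚ)) refl v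
∑-a₀-sat-both true  false v = solve 1 (λ v → con 0ℚ :+ con 0ℚ := v :* con ½ :* (con 1ℚ :+ :- con 1ℚ)) refl v
∑-a₀-sat-both true  true  v = solve 1 (λ v → con 0ℚ :+ v := v :* con ½ :* (con 1ℚ :+ con 1ℚ)) refl v

Prob₁-sat : ∀ lam {m} (σ : Assignment m) → Prob₁ lam (satXor σ) ≡ ½
Prob₁-sat lam {m} σ = begin
  Prob₁ lam (satXor σ)                     ≡⟨ ∑-allConstraints m _ ⟩
  ∑ (allVecs m) (λ a → 𝟙 (not (false xor xorSum a σ)) (½ * weight lam a) + 𝟙 (not (true xor xorSum a σ)) (½ * weight lam a))
                                           ≡⟨ ∑-cong (allVecs m) (λ a → ∑-a₀-sat (xorSum a σ) (½ * weight lam a)) ⟩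
  ∑ (allVecs m) (λ a → ½ * weight lam a)   ≡⟨ ∑-*ˡ (allVecs m) ½ (weight lam) ⟩
  ½ * ∑ (allVecs m) (weight lam)           ≡⟨ cong (½ *_) (∑-weight lam m) ⟩
  ½ * 1ℚ                                   ≡⟨ *-identityʳ ½ ⟩
  ½                                        ∎

Prob₁-sat-both : ∀ lam {m} (σ σ′ : Assignment m) →
                 Prob₁ lam (λ c → satXor σ c ∧ satXor σ′ c) ≡ (1ℚ + ρ lam ^ℚ hamming σ σ′) * (½ * ½)
Prob₁-sat-both lam {m} σ σ′ = begin
  Prob₁ lam (λ c → satXor σ c ∧ satXor σ′ c)            ≡⟨ ∑-allConstraints m _ ⟩
  ∑ (allVecs m) (λ a → 𝟙 (not (false xor xorSum a σ) ∧ not (false xor xorSum a σ′)) (½ * weight lam a)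
                     + 𝟙 (not (true xor xorSum a σ) ∧ not (true xor xorSum a σ′)) (½ * weight lam a))
                                                         ≡⟨ ∑-cong (allVecs m) (λ a → trans (∑-a₀-sat-both (xorSum a σ) (xorSum a σ′) (½ * weight lam a)) (expand a)) ⟩
  ∑ (allVecs m) (λ a → ¼ * weight lam a + ¼ * f a)       ≡⟨ ∑-+ (allVecs m) _ _ ⟩
  ∑ (allVecs m) (λ a → ¼ * weight lam a) + ∑ (allVecs m) (λ a → ¼ * f a)
                                                         ≡⟨ cong₂ _+_ (∑-*ˡ (allVecs m) ¼ (weight lam)) (∑-*ˡ (allVecs m) ¼ f) ⟩
  ¼ * ∑ (allVecs m) (weight lam) + ¼ * ∑ (allVecs m) f   ≡⟨ cong₂ (λ u v → ¼ * u + ¼ * v)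
                                                                  (∑-weight lam m) (∑-weight*sign≡ρ^hamming lam σ σ′) ⟩
  ¼ * 1ℚ + ¼ * ρ lam ^ℚ hamming σ σ′                     ≡⟨ solve 1 (λ r → con ¼ :* con 1ℚ :+ con ¼ :* r := (con 1ℚ :+ r) :* con ¼)
                                                                  refl (ρ lam ^ℚ hamming σ σ′) ⟩
  (1ℚ + ρ lam ^ℚ hamming σ σ′) * ¼                       ∎
  where
  ¼ : ℚ
  ¼ = ½ * ½
  f : Vec Bool m → ℚ
  f a = weight lam a * sign (xorSum a σ xor xorSum a σ′)
  expand : ∀ a → ½ * weight lam a * ½ * (1ℚ + sign (xorSum a σ xor xorSum a σ′)) ≡ ¼ * weight lam a + ¼ * f a
  expand a = solve 2 (λ w e → con ½ :* w :* con ½ :* (con 1ℚ :+ e) := con ½ :* con ½ :* w :+ con ½ :* con ½ :* (w :* e))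
                     refl (weight lam a) (sign (xorSum a σ xor xorSum a σ′))

every : {m s : ℕ} → (XorConstraint m → Bool) → Vec (XorConstraint m) s → Bool
every E cs = foldr _ (λ c r → E c ∧ r) true cs

Prob-every : ∀ lam m s (E : XorConstraint m → Bool) → Prob m s lam (every E) ≡ Prob₁ lam E ^ℚ s
Prob-every lam m zero    E = +-identityʳ 1ℚ
Prob-every lam m (suc s) E = begin
  Prob m (suc s) lam (every E)   ≡⟨ ∑-allSeqs-suc m s _ ⟩
  ∑ (allConstraints m) (λ c → ∑ (allSeqs m s) (λ cs → 𝟙 (E c ∧ every E cs) (constraintProb lam c * seqProb lam cs)))
                                 ≡⟨ ∑-cong (allConstraints m) (λ c → ∑-cong (allSeqs m s) (λ cs → 𝟙-∧ (E c) (every E cs) _ _)) ⟩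
  ∑ (allConstraints m) (λ c → ∑ (allSeqs m s) (λ cs → 𝟙 (E c) (constraintProb lam c) * 𝟙 (every E cs) (seqProb lam cs)))
                                 ≡⟨ ∑∑-* (allConstraints m) (allSeqs m s) _ _ ⟩
  Prob₁ lam E * Prob m s lam (every E) ≡⟨ cong (Prob₁ lam E *_) (Prob-every lam m s E) ⟩
  Prob₁ lam E * Prob₁ lam E ^ℚ s ∎

satχ-model : ∀ {m s} (φ : Formula m) σ → Model φ σ → (cs : Vec (XorConstraint m) s) → satχ φ σ cs ≡ every (satXor σ) cs
satχ-model φ σ σ⊨φ cs rewrite σ⊨φ = refl

every-∧ : ∀ {m s} (E F : XorConstraint m → Bool) (cs : Vec (XorConstraint m) s) →
          (every E cs ∧ every F cs) ≡ every (λ c → E c ∧ F c) cs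
every-∧ E F []       = refl
every-∧ E F (c ∷ cs) with E c | F c
... | true  | true  = every-∧ E F cs
... | true  | false = ∧-zeroʳ _
... | false | _     = refl

Prob-satχ : ∀ lam {m} s (φ : Formula m) σ → Model φ σ → Prob m s lam (satχ φ σ) ≡ ½ ^ℚ s
Prob-satχ lam {m} s φ σ σ⊨φ = begin
  Prob m s lam (satχ φ σ)          ≡⟨ Prob-cong m s lam (satχ-model φ σ σ⊨φ) ⟩
  Prob m s lam (every (satXor σ))  ≡⟨ Prob-every lam m s (satXor σ) ⟩
  Prob₁ lam (satXor σ) ^ℚ s        ≡⟨ cong (_^ℚ s) (Prob₁-sat lam σ) ⟩
  ½ ^ℚ s                           ∎

Prob-satχ-both : ∀ lam {m} s (φ : Formula m) σ σ′ → Model φ σ → Model φ σ′ →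
                 Prob m s lam (λ cs → satχ φ σ cs ∧ satχ φ σ′ cs) ≡ ((1ℚ + ρ lam ^ℚ hamming σ σ′) * (½ * ½)) ^ℚ s
Prob-satχ-both lam {m} s φ σ σ′ σ⊨φ σ′⊨φ = begin
  Prob m s lam (λ cs → satχ φ σ cs ∧ satχ φ σ′ cs)
    ≡⟨ Prob-cong m s lam (λ cs → trans (cong₂ _∧_ (satχ-model φ σ σ⊨φ cs) (satχ-model φ σ′ σ′⊨φ cs))
                                       (every-∧ (satXor σ) (satXor σ′) cs)) ⟩
  Prob m s lam (every (λ c → satXor σ c ∧ satXor σ′ c))
    ≡⟨ Prob-every lam m s _ ⟩
  Prob₁ lam (λ c → satXor σ c ∧ satXor σ′ c) ^ℚ s
    ≡⟨ cong (_^ℚ s) (Prob₁-sat-both lam σ σ′) ⟩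
  ((1ℚ + ρ lam ^ℚ hamming σ σ′) * (½ * ½)) ^ℚ s ∎

Expect-Y*Y : ∀ lam {m} s (φ : Formula m) σ σ′ →
             Expect m s lam (λ cs → Y φ σ cs * Y φ σ′ cs) ≡ Prob m s lam (λ cs → satχ φ σ cs ∧ satχ φ σ′ cs)
Expect-Y*Y lam {m} s φ σ σ′ =
  trans (∑-cong (allSeqs m s) (λ cs → cong (seqProb lam cs *_) (𝟙-1-∧ (satχ φ σ cs) (satχ φ σ′ cs))))
        (Expect-indicator m s lam _)

lemma1 : ∀ {m : ℕ} (φ : Formula m) (s : ℕ) → s ≥ 1 →
         (λ′ : ℚ) → 0ℚ < λ′ → λ′ ≤ ½ →
         ((σ : Assignment m) → Model φ σ →
            (Prob m s λ′ (satχ φ σ) ≡ ½ ^ℚ s)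
            × (Expect m s λ′ (Y φ σ) ≡ ½ ^ℚ s))
         × ((σ σ′ : Assignment m) → Model φ σ → Model φ σ′ →
            (Prob m s λ′ (λ cs → satχ φ σ cs ∧ satχ φ σ′ cs)
               ≡ ((1ℚ + ((1ℚ - (λ′ + λ′)) ^ℚ hamming σ σ′)) * (½ * ½)) ^ℚ s)
            × (Expect m s λ′ (λ cs → Y φ σ cs * Y φ σ′ cs)
               ≡ ((1ℚ + ((1ℚ - (λ′ + λ′)) ^ℚ hamming σ σ′)) * (½ * ½)) ^ℚ s))
lemma1 {m} φ s _ lam _ _ =
    (λ σ σ⊨φ → Prob-satχ lam s φ σ σ⊨φ
             , trans (Expect-indicator m s lam (satχ φ σ)) (Prob-satχ lam s φ σ σ⊨φ))
  , (λ σ σ′ σ⊨φ σ′⊨φ → Prob-satχ-both lam s φ σ σ′ σ⊨φ σ′⊨φ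
                     , trans (Expect-Y*Y lam s φ σ σ′) (Prob-satχ-both lam s φ σ σ′ σ⊨φ σ′⊨φ))
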